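{- Let $H=(a_1,\dots,a_n;\varepsilon_1,\dots,\varepsilon_n)$ be a naive EGK datum. Let $m_1<\dots<m_r$ be the distinct values among $a_1,\dots,a_n$, let $n_s=\#\{i:a_i=m_s\}$, $n^\ast_s=n_1+\dots+n_s$, and $\zeta_s=\varepsilon_{n^\ast_s}$. Then $G=(n_1,\dots,n_r;m_1,\dots,m_r;\zeta_1,\dots,\zeta_r)$ is an EGK datum of length $n$.
   Context: A naive EGK datum of length $n$ is $(a_1,\dots,a_n;\varepsilon_1,\dots,\varepsilon_n)\in\mathbb{Z}_{\ge0}^n\times\{0,1,-1\}^n$ with (N1) $a_1\le\cdots\le a_n$; (N2) for $i$ even, $\varepsilon_i\neq0$ iff $a_1+\dots+a_i$ is even; (N3) for $i$ odd, $\varepsilon_i\ne0$; (N4) $\varepsilon_1=1$; (N5) if $i\ge3$ is odd and $a_1+\dots+a_{i-1}$ is even, then $\varepsilon_i=\varepsilon_{i-2}\varepsilon_{i-1}^{a_i+a_{i-1}}$. An EGK datum of length $n$ is $(n_1,\dots,n_r;m_1,\dots,m_r;\zeta_1,\dots,\zeta_r)\in\mathbb{Z}_{>0}^r\times\mathbb{Z}_{\ge0}^r\times\{0,1,-1\}^r$, with $n^\ast_s=n_1+\dots+n_s$, such that (E1) $n^\ast_r=n$ and $m_1<\dots<m_r$; (E2) if $n^\ast_s$ is even, $\zeta_s\ne0$ iff $m_1n_1+\dots+m_sn_s$ is even; (E3) if $n^\ast_s$ is odd, then $\zeta_s\ne0$, and (a) if $n^\ast_i$ is even for all $i<s$, then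 $\zeta_s=\zeta_1^{m_1+m_2}\zeta_2^{m_2+m_3}\cdots\zeta_{s-1}^{m_{s-1}+m_s}$; (b) if $m_1n_1+\dots+m_{s-1}n_{s-1}+m_s(n_s-1)$ is even and $n^\ast_i$ is odd for some $i<s$, then with $t<s$ the largest such $i$, $\zeta_s=\zeta_t\zeta_{t+1}^{m_{t+1}+m_{t+2}}\cdots\zeta_{s-1}^{m_{s-1}+m_s}$. -}

module Defs where

open import Data.Nat using (ℕ; zero; suc; _+_; _*_; _∸_; _≤_; _<_)
open import Data.Nat.Divisibility using (_∣_)
open import Data.Nat.Properties using (_≟_)
open import Data.Bool using (if_then_else_)
open import Data.Product using (_×_; ∃-syntax)
open import Relation.Nullary using (¬_; does)
open import Relation.Binary.PropositionalEquality using (_≡_; _≢_)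
open import Function.Bundles using (_⇔_)

data Sign : Set where
  zer pos neg : Sign

infixl 7 _·_
_·_ : Sign → Sign → Sign
zer · _   = zer
pos · y   = y
neg · zer = zer
neg · pos = neg
neg · neg = pos

-- ordinary power with x ^ 0 = 1 (so 0 ^ 0 = 1)
infixr 8 _^_
_^_ : Sign → ℕ → Sign
x ^ zero  = pos
x ^ suc k = x · (x ^ k)

Even : ℕ → Set
Even k = 2 ∣ k

-- Sequences are 1-indexed: f : ℕ → _, only f 1, ..., f n matter.
-- psum f i = f 1 + ... + f i
psum : (ℕ → ℕ) → ℕ → ℕ
psum f zero    = 0
psum f (suc i) = psum f i + f (suc i)

chain : (ℕ → Sign) → (ℕ → ℕ) → ℕ → ℕ → Sign
chain ζ m lo zero      = pos
chain ζ m lo (suc len) = (ζ lo ^ (m lo + m (suc lo))) · chain ζ m (suc lo) len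

-- ζ_lo^{m_lo+m_{lo+1}} ⋯ ζ_{s-1}^{m_{s-1}+m_s}  (empty product = 1 if s ≤ lo)
chainTo : (ℕ → Sign) → (ℕ → ℕ) → ℕ → ℕ → Sign
chainTo ζ m lo s = chain ζ m lo (s ∸ lo)

record IsNaiveEGK (n : ℕ) (a : ℕ → ℕ) (ε : ℕ → Sign) : Set where
  field
    N1 : ∀ i j → 1 ≤ i → i ≤ j → j ≤ n → a i ≤ a j
    N2 : ∀ i → 1 ≤ i → i ≤ n → Even i → (ε i ≢ zer ⇔ Even (psum a i))
    N3 : ∀ i → 1 ≤ i → i ≤ n → ¬ Even i → ε i ≢ zer
    N4 : 1 ≤ n → ε 1 ≡ pos
    N5 : ∀ i → 3 ≤ i → i ≤ n → ¬ Even i → Even (psum a (i ∸ 1)) →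
         ε i ≡ ε (i ∸ 2) · (ε (i ∸ 1) ^ (a i + a (i ∸ 1)))

record IsEGK (n r : ℕ) (ns m : ℕ → ℕ) (ζ : ℕ → Sign) : Set where
  field
    E0 : ∀ s → 1 ≤ s → s ≤ r → 1 ≤ ns s
    E1a : psum ns r ≡ n
    E1b : ∀ s → 1 ≤ s → suc s ≤ r → m s < m (suc s)
    E2 : ∀ s → 1 ≤ s → s ≤ r → Even (psum ns s) →
         (ζ s ≢ zer ⇔ Even (psum (λ j → m j * ns j) s))
    E3 : ∀ s → 1 ≤ s → s ≤ r → ¬ Even (psum ns s) → ζ s ≢ zer
    E3a : ∀ s → 1 ≤ s → s ≤ r → ¬ Even (psum ns s) →
          (∀ i → 1 ≤ i → i < s → Even (psum ns i)) →
          ζ s ≡ chainTo ζ m 1 s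
    E3b : ∀ s → 1 ≤ s → s ≤ r → ¬ Even (psum ns s) →
          Even (psum (λ j → m j * ns j) (s ∸ 1) + m s * (ns s ∸ 1)) →
          ∀ t → 1 ≤ t → t < s → ¬ Even (psum ns t) →
          (∀ i → t < i → i < s → Even (psum ns i)) →
          ζ s ≡ ζ t · chainTo ζ m (suc t) s

count : (ℕ → ℕ) → ℕ → ℕ → ℕ
count a zero    v = 0
count a (suc i) v = count a i v + (if does (a (suc i) ≟ v) then 1 else 0)

-- Since a is monotone, n*_s = #{i ≤ n : a_i ≤ m_s}: the positions fall into blocks (n*_{s-1}, n*_s]
-- on which a = m_s, and a_1 + ⋯ + a_{n*_s} = m_1 n_1 + ⋯ + m_s n_s, so (E2) and (E3) are (N2) and (N3)
-- at the block ends. For (E3a) and (E3b), iterating (N5) from an odd position q to n*_s gives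
-- ε_{n*_s} = ε_q · ∏ ε_e ^ (a_e + a_{e+1}) over the even e in between, as long as each such
-- a_1 + ⋯ + a_e is even. Inside a block a_e = a_{e+1}, so the factor is 1 (ε_e ≠ 0 by (N2)), and only
-- the block ends n*_i, even by hypothesis, contribute ζ_i ^ (m_i + m_{i+1}). Those sums a_1 + ⋯ + a_e
-- all have the parity of a known even anchor (0, resp. a_1 + ⋯ + a_{n*_s - 1}): every pair of
-- positions (2k - 1, 2k) in range lies in a single block, since all block ends in range are even.
module Submission where

open import Defs
open import Data.Bool.Base using (if_then_else_)
open import Data.Nat.Base using (ℕ; zero; suc; _+_; _*_; _∸_; _≤_; _<_; z≤n; s≤s; parity)
open import Data.Nat.Divisibility using (divides; _∣0; ∣-refl; ∣m∣n⇒∣m+n)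
open import Data.Nat.Properties
open import Algebra.Properties.CommutativeSemigroup +-commutativeSemigroup using (interchange)
open import Data.Parity.Base as ℙ using (Parity; 0ℙ; 1ℙ; _⁻¹)
import Data.Parity.Properties as ℙₚ
open import Data.Product.Base using (_,_; _×_; ∃-syntax)
open import Data.Sum.Base using (_⊎_; inj₁; inj₂; [_,_]′)
open import Function.Base using (_∘_; flip)
open import Function.Bundles using (_⇔_; mk⇔; Equivalence)
open import Function.Properties.Equivalence using () renaming (trans to ⇔-trans)
open import Level using (0ℓ)
open import Relation.Nullary using (¬_; does; yes; no; contradiction)
open import Relation.Unary using (Pred; Decidable)
open import Relation.Binary.PropositionalEquality
open ≡-Reasoning

open Equivalence using (to; from)

+-suc-suc : ∀ m n → m + suc (suc n) ≡ suc (suc (m + n))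
+-suc-suc m n = trans (+-suc m (suc n)) (cong suc (+-suc m n))

parity-suc : ∀ k → parity (suc k) ≡ parity k ⁻¹
parity-suc zero          = refl
parity-suc (suc zero)    = refl
parity-suc (suc (suc k)) = parity-suc k

parity-double : ∀ x → parity (x + x) ≡ 0ℙ
parity-double x = trans (ℙₚ.+-homo-+ x x) (ℙₚ.p+p≡0ℙ (parity x))

parity-+-double : ∀ x y → parity (x + y + y) ≡ parity x
parity-+-double x y = begin
  parity (x + y + y)          ≡⟨ cong parity (+-assoc x y y) ⟩
  parity (x + (y + y))        ≡⟨ ℙₚ.+-homo-+ x (y + y) ⟩
  parity x ℙ.+ parity (y + y) ≡⟨ cong (parity x ℙ.+_) (parity-double y) ⟩
  parity x ℙ.+ 0ℙ             ≡⟨ ℙₚ.+-identityʳ (parity x) ⟩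
  parity x                    ∎

parity-∸ : ∀ {m n} → n ≤ m → parity n ≡ parity m → parity (m ∸ n) ≡ 0ℙ
parity-∸ {m} {n} n≤m same = ℙₚ.+-cancelˡ-≡ (parity n) _ _ (begin
  parity n ℙ.+ parity (m ∸ n) ≡⟨ ℙₚ.+-homo-+ n (m ∸ n) ⟨
  parity (n + (m ∸ n))        ≡⟨ cong parity (m+[n∸m]≡n n≤m) ⟩
  parity m                    ≡⟨ same ⟨
  parity n                    ≡⟨ ℙₚ.+-identityʳ (parity n) ⟨
  parity n ℙ.+ 0ℙ             ∎)

even⇒parity≡0ℙ : ∀ {k} → Even k → parity k ≡ 0ℙ
even⇒parity≡0ℙ (divides q refl) = trans (ℙₚ.*-homo-* q 2) (ℙₚ.*-zeroʳ (parity q))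

parity≡0ℙ⇒even : ∀ k → parity k ≡ 0ℙ → Even k
parity≡0ℙ⇒even zero          _    = 2 ∣0
parity≡0ℙ⇒even (suc (suc k)) even = ∣m∣n⇒∣m+n ∣-refl (parity≡0ℙ⇒even k even)

parity≡1ℙ⇒¬even : ∀ {k} → parity k ≡ 1ℙ → ¬ Even k
parity≡1ℙ⇒¬even odd ev with () ← trans (sym odd) (even⇒parity≡0ℙ ev)

¬even⇒parity≡1ℙ : ∀ k → ¬ Even k → parity k ≡ 1ℙ
¬even⇒parity≡1ℙ k ¬ev with parity k in eq
... | 0ℙ = contradiction (parity≡0ℙ⇒even k eq) ¬ev
... | 1ℙ = refl

·-identityʳ : ∀ x → x · pos ≡ x
·-identityʳ zer = refl
·-identityʳ pos = refl
·-identityʳ neg = refl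

·-assoc : ∀ x y z → x · y · z ≡ x · (y · z)
·-assoc zer y   z   = refl
·-assoc pos y   z   = refl
·-assoc neg zer z   = refl
·-assoc neg pos z   = refl
·-assoc neg neg zer = refl
·-assoc neg neg pos = refl
·-assoc neg neg neg = refl

^-even : ∀ {x} k → x ≢ zer → parity k ≡ 0ℙ → x ^ k ≡ pos
^-even zero _ _ = refl
^-even {zer} (suc (suc k)) x≢zer _    = contradiction refl x≢zer
^-even {pos} (suc (suc k)) x≢zer even = ^-even k x≢zer even
^-even {neg} (suc (suc k)) x≢zer even rewrite ^-even {neg} k x≢zer even = refl

∏ : (ℕ → Sign) → ℕ → ℕ → Sign
∏ f lo zero      = pos
∏ f lo (suc len) = ∏ f lo len · f (suc (lo + len))

∏-+ : ∀ f lo x y → ∏ f lo (x + y) ≡ ∏ f lo x · ∏ f (lo + x) y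
∏-+ f lo x zero    = trans (cong (∏ f lo) (+-identityʳ x)) (sym (·-identityʳ _))
∏-+ f lo x (suc y) = begin
  ∏ f lo (x + suc y)                               ≡⟨ cong (∏ f lo) (+-suc x y) ⟩
  ∏ f lo (x + y) · f (suc (lo + (x + y)))          ≡⟨ cong₂ _·_ (∏-+ f lo x y)
                                                              (cong (f ∘ suc) (sym (+-assoc lo x y))) ⟩
  ∏ f lo x · ∏ f (lo + x) y · f (suc (lo + x + y)) ≡⟨ ·-assoc (∏ f lo x) (∏ f (lo + x) y) _ ⟩
  ∏ f lo x · ∏ f (lo + x) (suc y)                  ∎

∏-cons : ∀ f lo len → ∏ f lo (suc len) ≡ f (suc lo) · ∏ f (suc lo) len
∏-cons f lo zero      = trans (cong (f ∘ suc) (+-identityʳ lo)) (sym (·-identityʳ _))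
∏-cons f lo (suc len) = begin
  ∏ f lo (suc len) · f (suc (lo + suc len))              ≡⟨ cong₂ _·_ (∏-cons f lo len)
                                                                    (cong (f ∘ suc) (+-suc lo len)) ⟩
  f (suc lo) · ∏ f (suc lo) len · f (suc (suc lo + len)) ≡⟨ ·-assoc (f (suc lo)) (∏ f (suc lo) len) _ ⟩
  f (suc lo) · ∏ f (suc lo) (suc len)                    ∎

∏-pos : ∀ f lo len → (∀ p → lo < p → p ≤ lo + len → f p ≡ pos) → ∏ f lo len ≡ pos
∏-pos f lo zero      _       = refl
∏-pos f lo (suc len) all-pos = cong₂ _·_
  (∏-pos f lo len (λ p lo<p p≤ → all-pos p lo<p (≤-trans p≤ (+-monoʳ-≤ lo (n≤1+n len)))))
  (all-pos (suc (lo + len)) (s≤s (m≤m+n lo len)) (≤-reflexive (sym (+-suc lo len))))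

∏-last : ∀ f lo len → 1 ≤ len → (∀ p → lo < p → p < lo + len → f p ≡ pos) → ∏ f lo len ≡ f (lo + len)
∏-last f lo (suc len) _ interior = begin
  ∏ f lo len · f (suc (lo + len)) ≡⟨ cong (_· f (suc (lo + len))) (∏-pos f lo len below-last) ⟩
  f (suc (lo + len))              ≡⟨ cong f (+-suc lo len) ⟨
  f (lo + suc len)                ∎
  where
  below-last : ∀ p → lo < p → p ≤ lo + len → f p ≡ pos
  below-last p lo<p p≤ = interior p lo<p (≤-trans (s≤s p≤) (≤-reflexive (sym (+-suc lo len))))

link : (ℕ → Sign) → (ℕ → ℕ) → ℕ → Sign
link ζ m i = ζ i ^ (m i + m (suc i))

chain≡∏ : ∀ ζ m lo len → chain ζ m (suc lo) len ≡ ∏ (link ζ m) lo len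
chain≡∏ ζ m lo zero      = refl
chain≡∏ ζ m lo (suc len) =
  trans (cong (link ζ m (suc lo) ·_) (chain≡∏ ζ m (suc lo) len)) (sym (∏-cons (link ζ m) lo len))

psum-mono : ∀ f {i} j → i ≤ j → psum f i ≤ psum f j
psum-mono f zero    z≤n   = ≤-refl
psum-mono f (suc j) i≤1+j with m≤n⇒m<n∨m≡n i≤1+j
... | inj₁ (s≤s i≤j) = ≤-trans (psum-mono f j i≤j) (m≤m+n _ _)
... | inj₂ refl      = ≤-refl

psum-const : ∀ f c p k → (∀ i → p < i → i ≤ p + k → f i ≡ c) → psum f (p + k) ≡ psum f p + c * k
psum-const f c p zero _ rewrite +-identityʳ p | *-zeroʳ c = sym (+-identityʳ _)
psum-const f c p (suc k) const = begin
  psum f (p + suc k)               ≡⟨ cong (psum f) (+-suc p k) ⟩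
  psum f (p + k) + f (suc (p + k)) ≡⟨ cong₂ _+_ (psum-const f c p k below-last) last ⟩
  psum f p + c * k + c             ≡⟨ +-assoc (psum f p) (c * k) c ⟩
  psum f p + (c * k + c)           ≡⟨ cong (psum f p +_) (trans (+-comm (c * k) c) (sym (*-suc c k))) ⟩
  psum f p + c * suc k             ∎
  where
  below-last : ∀ i → p < i → i ≤ p + k → f i ≡ c
  below-last i p<i i≤ = const i p<i (≤-trans i≤ (+-monoʳ-≤ p (n≤1+n k)))
  last : f (suc (p + k)) ≡ c
  last = const (suc (p + k)) (s≤s (m≤m+n p k)) (≤-reflexive (sym (+-suc p k)))

psum-pairs : ∀ f {lo hi} → lo ≤ hi → parity lo ≡ 0ℙ → parity hi ≡ 0ℙ →
             (∀ o → lo < o → o < hi → parity o ≡ 1ℙ → f o ≡ f (suc o)) →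
             parity (psum f hi) ≡ parity (psum f lo)
psum-pairs f {lo} {hi} lo≤hi lo-even hi-even pair-const =
  trans (cong (parity ∘ psum f) (sym (m+[n∸m]≡n lo≤hi)))
        (pairs (hi ∸ lo) (parity-∸ lo≤hi (trans lo-even (sym hi-even)))
               (λ o lo<o o< → pair-const o lo<o (≤-trans o< (≤-reflexive (m+[n∸m]≡n lo≤hi)))))
  where
  pairs : ∀ len → parity len ≡ 0ℙ → (∀ o → lo < o → o < lo + len → parity o ≡ 1ℙ → f o ≡ f (suc o)) →
          parity (psum f (lo + len)) ≡ parity (psum f lo)
  pairs zero                _        _     = cong (parity ∘ psum f) (+-identityʳ lo)
  pairs (suc (suc len)) len-even const = begin
    parity (psum f (lo + suc (suc len)))               ≡⟨ cong (parity ∘ psum f) (+-suc-suc lo len) ⟩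
    parity (psum f (lo + len) + f o + f (suc o))       ≡⟨ cong (λ y → parity (psum f (lo + len) + y + f (suc o)))
                                                               (const o (s≤s (m≤m+n lo len)) o<end o-odd) ⟩
    parity (psum f (lo + len) + f (suc o) + f (suc o)) ≡⟨ parity-+-double (psum f (lo + len)) (f (suc o)) ⟩
    parity (psum f (lo + len))                         ≡⟨ pairs len len-even (λ p lo<p p< → const p lo<p
                                                             (<-≤-trans p< (+-monoʳ-≤ lo (m≤n+m len 2)))) ⟩
    parity (psum f lo)                                 ∎
    where
    o : ℕ
    o = suc (lo + len)
    o<end : o < lo + suc (suc len)
    o<end = ≤-reflexive (sym (+-suc-suc lo len))
    o-odd : parity o ≡ 1ℙ
    o-odd = trans (parity-suc (lo + len))
                  (cong _⁻¹ (trans (ℙₚ.+-homo-+ lo len) (cong₂ ℙ._+_ lo-even len-even)))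

tally : {P : Pred ℕ 0ℓ} → Decidable P → ℕ → ℕ
tally P? zero    = 0
tally P? (suc k) = tally P? k + (if does (P? (suc k)) then 1 else 0)

count≡tally : ∀ a k v → count a k v ≡ tally (λ i → a i ≟ v) k
count≡tally a zero    v = refl
count≡tally a (suc k) v = cong (_+ (if does (a (suc k) ≟ v) then 1 else 0)) (count≡tally a k v)

module _ {P : Pred ℕ 0ℓ} (P? : Decidable P) where

  tally-≤ : ∀ k → tally P? k ≤ k
  tally-≤ zero = z≤n
  tally-≤ (suc k) with P? (suc k)
  ... | yes _ = ≤-trans (+-monoˡ-≤ 1 (tally-≤ k)) (≤-reflexive (+-comm k 1))
  ... | no _  = ≤-trans (≤-reflexive (+-identityʳ _)) (m≤n⇒m≤1+n (tally-≤ k))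

  tally-all : ∀ k → (∀ i → 1 ≤ i → i ≤ k → P i) → tally P? k ≡ k
  tally-all zero    _     = refl
  tally-all (suc k) all-P with P? (suc k)
  ... | yes _ = trans (cong (_+ 1) (tally-all k (λ i 1≤i i≤k → all-P i 1≤i (m≤n⇒m≤1+n i≤k)))) (+-comm k 1)
  ... | no ¬P = contradiction (all-P (suc k) (s≤s z≤n) ≤-refl) ¬P

  tally-downClosed : ∀ k → (∀ i j → 1 ≤ i → i ≤ j → j ≤ k → P j → P i) →
                     ∀ i → 1 ≤ i → i ≤ k → (i ≤ tally P? k ⇔ P i)
  tally-downClosed zero    _      i 1≤i i≤0   = contradiction i≤0 (<⇒≱ 1≤i)
  tally-downClosed (suc k) closed i 1≤i i≤1+k with P? (suc k)
  ... | yes P1+k = mk⇔ (λ _ → closed i (suc k) 1≤i i≤1+k ≤-refl P1+k)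
                       (λ _ → ≤-trans i≤1+k (≤-reflexive (sym tally≡1+k)))
    where
    tally≡1+k : tally P? k + 1 ≡ suc k
    tally≡1+k = trans (cong (_+ 1) (tally-all k λ j 1≤j j≤k →
                                      closed j (suc k) 1≤j (m≤n⇒m≤1+n j≤k) ≤-refl P1+k))
                      (+-comm k 1)
  ... | no ¬P1+k with m≤n⇒m<n∨m≡n i≤1+k
  ...   | inj₁ (s≤s i≤k) = mk⇔ (λ i≤ → to ih (≤-trans i≤ (≤-reflexive (+-identityʳ _))))
                                (λ Pi → ≤-trans (from ih Pi) (≤-reflexive (sym (+-identityʳ _))))
    where
    ih : i ≤ tally P? k ⇔ P i
    ih = tally-downClosed k (λ i j 1≤i i≤j j≤k → closed i j 1≤i i≤j (m≤n⇒m≤1+n j≤k)) i 1≤i i≤k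
  ...   | inj₂ refl = mk⇔ (λ 1+k≤ → contradiction (≤-trans 1+k≤ (≤-reflexive (+-identityʳ _)))
                                                    (<⇒≱ (s≤s (tally-≤ k))))
                          (λ P1+k → contradiction P1+k ¬P1+k)

module _ {P Q : Pred ℕ 0ℓ} (P? : Decidable P) (Q? : Decidable Q) where

  tally-cong : ∀ k → (∀ i → 1 ≤ i → i ≤ k → (P i ⇔ Q i)) → tally P? k ≡ tally Q? k
  tally-cong zero _ = refl
  tally-cong (suc k) P⇔Q
    with P? (suc k) | Q? (suc k) | tally-cong k (λ i 1≤i i≤k → P⇔Q i 1≤i (m≤n⇒m≤1+n i≤k))
  ... | yes _ | yes _ | ih = cong (_+ 1) ih
  ... | no _  | no _  | ih = cong (_+ 0) ih
  ... | yes p | no ¬q | _  = contradiction (to (P⇔Q (suc k) (s≤s z≤n) ≤-refl) p) ¬q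
  ... | no ¬p | yes q | _  = contradiction (from (P⇔Q (suc k) (s≤s z≤n) ≤-refl) q) ¬p

module _ {P Q R : Pred ℕ 0ℓ} (P? : Decidable P) (Q? : Decidable Q) (R? : Decidable R) where

  tally-⊎ : ∀ k → (∀ i → 1 ≤ i → i ≤ k → (R i ⇔ (P i ⊎ Q i))) →
            (∀ i → 1 ≤ i → i ≤ k → P i → ¬ Q i) → tally P? k + tally Q? k ≡ tally R? k
  tally-⊎ zero _ _ = refl
  tally-⊎ (suc k) R⇔P⊎Q disjoint
    with P? (suc k) | Q? (suc k) | R? (suc k)
       | tally-⊎ k (λ i 1≤i i≤k → R⇔P⊎Q i 1≤i (m≤n⇒m≤1+n i≤k))
                   (λ i 1≤i i≤k → disjoint i 1≤i (m≤n⇒m≤1+n i≤k))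
  ... | yes _ | no _  | yes _ | ih = trans (interchange (tally P? k) 1 (tally Q? k) 0) (cong (_+ 1) ih)
  ... | no _  | yes _ | yes _ | ih = trans (interchange (tally P? k) 0 (tally Q? k) 1) (cong (_+ 1) ih)
  ... | no _  | no _  | no _  | ih = trans (interchange (tally P? k) 0 (tally Q? k) 0) (cong (_+ 0) ih)
  ... | yes p | yes q | _     | _  = contradiction q (disjoint (suc k) (s≤s z≤n) ≤-refl p)
  ... | yes p | no _  | no ¬r | _  = contradiction (from (R⇔P⊎Q (suc k) (s≤s z≤n) ≤-refl) (inj₁ p)) ¬r
  ... | no _  | yes q | no ¬r | _  = contradiction (from (R⇔P⊎Q (suc k) (s≤s z≤n) ≤-refl) (inj₂ q)) ¬r
  ... | no ¬p | no ¬q | yes r | _  =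
    [ flip contradiction ¬p , flip contradiction ¬q ]′ (to (R⇔P⊎Q (suc k) (s≤s z≤n) ≤-refl) r)

module NaiveEGK {n : ℕ} {a : ℕ → ℕ} {ε : ℕ → Sign} (naive : IsNaiveEGK n a ε) where

  open IsNaiveEGK naive

  onEven : Parity → Sign → Sign
  onEven 0ℙ x = x
  onEven 1ℙ _ = pos

  -- (N5) says ε (e + 1) ≡ ε (e ∸ 1) · factor e at even e; odd e contribute nothing.
  factor : ℕ → Sign
  factor e = onEven (parity e) (ε e ^ (a e + a (suc e)))

  factor-odd : ∀ {e} → parity e ≡ 1ℙ → factor e ≡ pos
  factor-odd {e} odd = cong (λ p → onEven p (ε e ^ (a e + a (suc e)))) odd

  factor-even : ∀ {e} → parity e ≡ 0ℙ → factor e ≡ ε e ^ (a e + a (suc e))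
  factor-even {e} even = cong (λ p → onEven p (ε e ^ (a e + a (suc e)))) even

  EvenPsumOn : ℕ → ℕ → Set
  EvenPsumOn lo hi = ∀ e → lo < e → e < hi → parity e ≡ 0ℙ → parity (psum a e) ≡ 0ℙ

  ε≢zer : ∀ {lo hi} → hi ≤ n → EvenPsumOn lo hi →
          ∀ e → lo < e → e < hi → parity e ≡ 0ℙ → ε e ≢ zer
  ε≢zer hi≤n evenPsum e lo<e e<hi e-even =
    from (N2 e (≤-<-trans z≤n lo<e) (≤-trans (<⇒≤ e<hi) hi≤n) (parity≡0ℙ⇒even e e-even))
         (parity≡0ℙ⇒even _ (evenPsum e lo<e e<hi e-even))

  telescope : ∀ q len → 1 ≤ q → parity q ≡ 1ℙ → parity len ≡ 0ℙ → q + len ≤ n →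
              EvenPsumOn q (q + len) → ε (q + len) ≡ ε q · ∏ factor q len
  telescope q zero _ _ _ _ _ = trans (cong ε (+-identityʳ q)) (sym (·-identityʳ (ε q)))
  telescope q (suc (suc len)) 1≤q q-odd len-even bound evenPsum = begin
    ε (q + suc (suc len))                   ≡⟨ cong ε (+-suc-suc q len) ⟩
    ε (suc e)                               ≡⟨ N5 (suc e) (s≤s (s≤s (≤-trans 1≤q (m≤m+n q len))))
                                                  (≤-trans (≤-reflexive (sym (+-suc-suc q len))) bound)
                                                  (parity≡1ℙ⇒¬even q+len-odd) (parity≡0ℙ⇒even _ e-psum-even) ⟩
    ε (q + len) · ε e ^ (a (suc e) + a e)   ≡⟨ cong₂ _·_ ih (trans (cong (ε e ^_) (+-comm (a (suc e)) (a e)))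
                                                                  (sym (factor-even e-even))) ⟩
    ε q · ∏ factor q len · factor e         ≡⟨ ·-assoc (ε q) (∏ factor q len) (factor e) ⟩
    ε q · (∏ factor q len · factor e)       ≡⟨ cong (ε q ·_) (·-identityʳ _) ⟨
    ε q · (∏ factor q len · factor e · pos) ≡⟨ cong (λ x → ε q · (∏ factor q len · factor e · x))
                                                    (factor-odd last-odd) ⟨
    ε q · ∏ factor q (suc (suc len))        ∎
    where
    e : ℕ
    e = suc (q + len)
    q+len-odd : parity (q + len) ≡ 1ℙ
    q+len-odd = trans (ℙₚ.+-homo-+ q len) (cong₂ ℙ._+_ q-odd len-even)
    e-even : parity e ≡ 0ℙ
    e-even = trans (parity-suc (q + len)) (cong _⁻¹ q+len-odd)
    last-odd : parity (suc (q + suc len)) ≡ 1ℙ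
    last-odd = trans (cong (parity ∘ suc) (+-suc q len)) q+len-odd
    e-psum-even : parity (psum a e) ≡ 0ℙ
    e-psum-even = evenPsum e (s≤s (m≤m+n q len)) (≤-reflexive (sym (+-suc-suc q len))) e-even
    shorter : q + len ≤ q + suc (suc len)
    shorter = +-monoʳ-≤ q (m≤n+m len 2)
    ih : ε (q + len) ≡ ε q · ∏ factor q len
    ih = telescope q len 1≤q q-odd len-even (≤-trans shorter bound)
                   (λ e′ q<e′ e′< → evenPsum e′ q<e′ (<-≤-trans e′< shorter))

  module Grouping (r : ℕ) (m : ℕ → ℕ)
    (m-step : ∀ s → 1 ≤ s → suc s ≤ r → m s < m (suc s))
    (value : ∀ i → 1 ≤ i → i ≤ n → ∃[ s ] (1 ≤ s × s ≤ r × a i ≡ m s))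
    (attained : ∀ s → 1 ≤ s → s ≤ r → ∃[ i ] (1 ≤ i × i ≤ n × a i ≡ m s)) where

    ns : ℕ → ℕ
    ns s = count a n (m s)

    B : ℕ → ℕ
    B = psum ns

    ζ : ℕ → Sign
    ζ s = ε (B s)

    m-strict : ∀ {t s} → 1 ≤ t → t < s → s ≤ r → m t < m s
    m-strict {t} {suc s} 1≤t (s≤s t≤s) 1+s≤r with m≤n⇒m<n∨m≡n t≤s
    ... | inj₁ t<s  = <-trans (m-strict 1≤t t<s (≤-trans (n≤1+n s) 1+s≤r))
                              (m-step s (≤-trans 1≤t (<⇒≤ t<s)) 1+s≤r)
    ... | inj₂ refl = m-step t 1≤t 1+s≤r

    m-≤⇔≤ : ∀ {t s} → 1 ≤ t → t ≤ r → 1 ≤ s → s ≤ r → (m t ≤ m s ⇔ t ≤ s)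
    m-≤⇔≤ 1≤t t≤r 1≤s s≤r = mk⇔
      (λ mt≤ms → ≮⇒≥ (λ s<t → <⇒≱ (m-strict 1≤s s<t t≤r) mt≤ms))
      (λ t≤s → [ <⇒≤ ∘ (λ t<s → m-strict 1≤t t<s s≤r) , ≤-reflexive ∘ cong m ]′
                 (m≤n⇒m<n∨m≡n t≤s))

    ≤-m-suc⇔ : ∀ {s i} → 1 ≤ s → suc s ≤ r → 1 ≤ i → i ≤ n →
               (a i ≤ m (suc s) ⇔ (a i ≤ m s ⊎ a i ≡ m (suc s)))
    ≤-m-suc⇔ {s} {i} 1≤s 1+s≤r 1≤i i≤n with value i 1≤i i≤n
    ... | t , 1≤t , t≤r , ai≡mt rewrite ai≡mt = mk⇔ split merge
      where
      split : m t ≤ m (suc s) → m t ≤ m s ⊎ m t ≡ m (suc s)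
      split mt≤ with m≤n⇒m<n∨m≡n (to (m-≤⇔≤ 1≤t t≤r (s≤s z≤n) 1+s≤r) mt≤)
      ... | inj₁ (s≤s t≤s) = inj₁ (from (m-≤⇔≤ 1≤t t≤r 1≤s (≤-trans (n≤1+n s) 1+s≤r)) t≤s)
      ... | inj₂ refl      = inj₂ refl
      merge : m t ≤ m s ⊎ m t ≡ m (suc s) → m t ≤ m (suc s)
      merge = [ (λ mt≤ms → ≤-trans mt≤ms (<⇒≤ (m-step s 1≤s 1+s≤r))) , ≤-reflexive ]′

    B-tally : ∀ s → 1 ≤ s → s ≤ r → B s ≡ tally (λ i → a i ≤? m s) n
    B-tally (suc zero) _ 1≤r =
      trans (count≡tally a n (m 1))
            (tally-cong _ _ n λ i 1≤i i≤n → mk⇔ ≤-reflexive (≤m₁⇒≡m₁ i 1≤i i≤n))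
      where
      ≤m₁⇒≡m₁ : ∀ i → 1 ≤ i → i ≤ n → a i ≤ m 1 → a i ≡ m 1
      ≤m₁⇒≡m₁ i 1≤i i≤n ai≤m₁ with value i 1≤i i≤n
      ... | t , 1≤t , t≤r , ai≡mt =
        ≤-antisym ai≤m₁ (subst (m 1 ≤_) (sym ai≡mt) (from (m-≤⇔≤ (s≤s z≤n) 1≤r 1≤t t≤r) 1≤t))
    B-tally (suc (suc s)) _ 2+s≤r = begin
      B (suc s) + ns (suc (suc s))
        ≡⟨ cong₂ _+_ (B-tally (suc s) (s≤s z≤n) (≤-trans (n≤1+n _) 2+s≤r))
                     (count≡tally a n (m (suc (suc s)))) ⟩
      tally (λ i → a i ≤? m (suc s)) n + tally (λ i → a i ≟ m (suc (suc s))) n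
        ≡⟨ tally-⊎ _ _ _ n (λ i 1≤i i≤n → ≤-m-suc⇔ (s≤s z≤n) 2+s≤r 1≤i i≤n) disjoint ⟩
      tally (λ i → a i ≤? m (suc (suc s))) n
        ∎
      where
      disjoint : ∀ i → 1 ≤ i → i ≤ n → a i ≤ m (suc s) → a i ≢ m (suc (suc s))
      disjoint i _ _ ai≤ ai≡ = <⇒≱ (m-step (suc s) (s≤s z≤n) 2+s≤r) (subst (_≤ m (suc s)) ai≡ ai≤)

    ≤B⇔≤ : ∀ {i t} s → s ≤ r → 1 ≤ i → i ≤ n → 1 ≤ t → t ≤ r → a i ≡ m t → (i ≤ B s ⇔ t ≤ s)
    ≤B⇔≤ zero _ 1≤i _ 1≤t _ _ = mk⇔ (absurd 1≤i) (absurd 1≤t)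
      where
      absurd : ∀ {k} {A : Set} → 1 ≤ k → k ≤ 0 → A
      absurd 1≤k k≤0 = contradiction k≤0 (<⇒≱ 1≤k)
    ≤B⇔≤ {i} {t} (suc s) s≤r 1≤i i≤n 1≤t t≤r ai≡mt = ⇔-trans
      (subst (λ x → (i ≤ x) ⇔ (a i ≤ m (suc s))) (sym (B-tally (suc s) (s≤s z≤n) s≤r))
             (tally-downClosed _ n (λ i j 1≤i i≤j j≤n aj≤ → ≤-trans (N1 i j 1≤i i≤j j≤n) aj≤) i 1≤i i≤n))
      (subst (λ x → (x ≤ m (suc s)) ⇔ (t ≤ suc s)) (sym ai≡mt) (m-≤⇔≤ 1≤t t≤r (s≤s z≤n) s≤r))

    B≤n : ∀ s → s ≤ r → B s ≤ n
    B≤n zero    _   = z≤n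
    B≤n (suc s) s≤r = subst (_≤ n) (sym (B-tally (suc s) (s≤s z≤n) s≤r)) (tally-≤ _ n)

    B-r : B r ≡ n
    B-r = ≤-antisym (B≤n r ≤-refl) (≤B-r n ≤-refl)
      where
      ≤B-r : ∀ i → i ≤ n → i ≤ B r
      ≤B-r zero    _     = z≤n
      ≤B-r (suc i) 1+i≤n with value (suc i) (s≤s z≤n) 1+i≤n
      ... | t , 1≤t , t≤r , ai≡mt = from (≤B⇔≤ r ≤-refl (s≤s z≤n) 1+i≤n 1≤t t≤r ai≡mt) t≤r

    block-value : ∀ {j i} → suc j ≤ r → B j < i → i ≤ B (suc j) → a i ≡ m (suc j)
    block-value {j} {i} 1+j≤r Bj<i i≤B = at-index (value i 1≤i i≤n)
      where
      1≤i : 1 ≤ i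
      1≤i = ≤-<-trans z≤n Bj<i
      i≤n : i ≤ n
      i≤n = ≤-trans i≤B (B≤n (suc j) 1+j≤r)
      at-index : ∃[ t ] (1 ≤ t × t ≤ r × a i ≡ m t) → a i ≡ m (suc j)
      at-index (t , 1≤t , t≤r , ai≡mt) = trans ai≡mt (cong m (≤-antisym t≤1+j j<t))
        where
        t≤1+j : t ≤ suc j
        t≤1+j = to (≤B⇔≤ (suc j) 1+j≤r 1≤i i≤n 1≤t t≤r ai≡mt) i≤B
        j<t : j < t
        j<t = ≰⇒> λ t≤j →
          <⇒≱ Bj<i (from (≤B⇔≤ j (≤-trans (n≤1+n j) 1+j≤r) 1≤i i≤n 1≤t t≤r ai≡mt) t≤j)

    within-block : ∀ {j i} → suc j ≤ r → 1 ≤ i → i ≤ n → a i ≡ m (suc j) → B j < i × i ≤ B (suc j)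
    within-block {j} 1+j≤r 1≤i i≤n ai≡m =
      ≰⇒> (λ i≤Bj → 1+n≰n (to (≤B⇔≤ j (≤-trans (n≤1+n j) 1+j≤r) 1≤i i≤n (s≤s z≤n) 1+j≤r ai≡m)
                                i≤Bj)) ,
      from (≤B⇔≤ (suc j) 1+j≤r 1≤i i≤n (s≤s z≤n) 1+j≤r ai≡m) ≤-refl

    B-strict : ∀ {j} → suc j ≤ r → B j < B (suc j)
    B-strict {j} 1+j≤r with attained (suc j) (s≤s z≤n) 1+j≤r
    ... | i , 1≤i , i≤n , ai≡m =
      let (Bj<i , i≤B) = within-block 1+j≤r 1≤i i≤n ai≡m in <-≤-trans Bj<i i≤B

    B-< : ∀ {t s} → t < s → s ≤ r → B t < B s
    B-< {t} {suc s} (s≤s t≤s) 1+s≤r = ≤-<-trans (psum-mono ns s t≤s) (B-strict 1+s≤r)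

    B-<⇒< : ∀ {i j} → B i < B j → i < j
    B-<⇒< {i} {j} Bi<Bj = ≰⇒> (λ j≤i → <⇒≱ Bi<Bj (psum-mono ns i j≤i))

    ns-pos : ∀ {j} → suc j ≤ r → 1 ≤ ns (suc j)
    ns-pos {j} 1+j≤r =
      +-cancelˡ-≤ (B j) 1 (ns (suc j)) (subst (_≤ B (suc j)) (+-comm 1 (B j)) (B-strict 1+j≤r))

    psum-a-B : ∀ s → s ≤ r → psum a (B s) ≡ psum (λ j → m j * ns j) s
    psum-a-B zero    _     = refl
    psum-a-B (suc s) 1+s≤r =
      trans (psum-const a (m (suc s)) (B s) (ns (suc s)) (λ i Bs<i i≤ → block-value 1+s≤r Bs<i i≤))
            (cong (_+ m (suc s) * ns (suc s)) (psum-a-B s (≤-trans (n≤1+n s) 1+s≤r)))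

    psum-a-before-B : ∀ s → 1 ≤ s → s ≤ r →
                      psum a (B s ∸ 1) ≡ psum (λ j → m j * ns j) (s ∸ 1) + m s * (ns s ∸ 1)
    psum-a-before-B (suc s) _ 1+s≤r = begin
      psum a (B s + ns (suc s) ∸ 1)               ≡⟨ cong (psum a) (+-∸-assoc (B s) (ns-pos 1+s≤r)) ⟩
      psum a (B s + (ns (suc s) ∸ 1))             ≡⟨ psum-const a (m (suc s)) (B s) (ns (suc s) ∸ 1) in-block ⟩
      psum a (B s) + m (suc s) * (ns (suc s) ∸ 1) ≡⟨ cong (_+ m (suc s) * (ns (suc s) ∸ 1))
                                                          (psum-a-B s (≤-trans (n≤1+n s) 1+s≤r)) ⟩
      psum (λ j → m j * ns j) s + m (suc s) * (ns (suc s) ∸ 1) ∎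
      where
      in-block : ∀ i → B s < i → i ≤ B s + (ns (suc s) ∸ 1) → a i ≡ m (suc s)
      in-block i Bs<i i≤ = block-value 1+s≤r Bs<i (≤-trans i≤ (+-monoʳ-≤ (B s) (m∸n≤m (ns (suc s)) 1)))

    a-off-boundary : ∀ o → 1 ≤ o → o < n → (∀ i → B i ≢ o) → a o ≡ a (suc o)
    a-off-boundary o 1≤o o<n not-boundary with value o 1≤o (<⇒≤ o<n)
    ... | suc j , _ , 1+j≤r , ao≡m =
      let (Bj<o , o≤B) = within-block 1+j≤r 1≤o (<⇒≤ o<n) ao≡m in
      trans ao≡m (sym (block-value 1+j≤r (<-≤-trans Bj<o (n≤1+n o))
                                         (≤∧≢⇒< o≤B (not-boundary (suc j) ∘ sym))))

    EvenBoundaries : ℕ → ℕ → Set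
    EvenBoundaries t s = ∀ i → t < i → i < s → parity (B i) ≡ 0ℙ

    a-odd-pair : ∀ {t s} → s ≤ r → EvenBoundaries t s →
                 ∀ o → B t < o → o < B s → parity o ≡ 1ℙ → a o ≡ a (suc o)
    a-odd-pair {t} {s} s≤r even-B o Bt<o o<Bs o-odd =
      a-off-boundary o (≤-<-trans z≤n Bt<o) (<-≤-trans o<Bs (B≤n s s≤r)) not-boundary
      where
      not-boundary : ∀ i → B i ≢ o
      not-boundary i refl with () ← trans (sym o-odd) (even-B i (B-<⇒< Bt<o) (B-<⇒< o<Bs))

    evenPsumOn : ∀ {t s} → s ≤ r → EvenBoundaries t s → ∀ x → B t ≤ x → x < B s →
                 parity x ≡ 0ℙ → parity (psum a x) ≡ 0ℙ → EvenPsumOn (B t) (B s)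
    evenPsumOn s≤r even-B x Bt≤x x<Bs x-even x-psum-even e Bt<e e<Bs e-even with ≤-total x e
    ... | inj₁ x≤e = trans (psum-pairs a x≤e x-even e-even λ o x<o o<e →
                              a-odd-pair s≤r even-B o (≤-<-trans Bt≤x x<o) (<-trans o<e e<Bs))
                           x-psum-even
    ... | inj₂ e≤x = trans (sym (psum-pairs a e≤x e-even x-even λ o e<o o<x →
                                   a-odd-pair s≤r even-B o (<-trans Bt<e e<o) (<-trans o<x x<Bs)))
                           x-psum-even

    block-product : ∀ {j} → suc j ≤ r → EvenPsumOn (B j) (B (suc j)) →
                    ∏ factor (B j) (ns (suc j)) ≡ factor (B (suc j))
    block-product {j} 1+j≤r evenPsum = ∏-last factor (B j) (ns (suc j)) (ns-pos 1+j≤r) interior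
      where
      interior : ∀ p → B j < p → p < B (suc j) → factor p ≡ pos
      interior p Bj<p p<B with parity p in p-parity
      ... | 1ℙ = refl
      ... | 0ℙ = begin
        ε p ^ (a p + a (suc p))       ≡⟨ cong₂ (λ x y → ε p ^ (x + y))
                                               (block-value 1+j≤r Bj<p (<⇒≤ p<B))
                                               (block-value 1+j≤r (<-≤-trans Bj<p (n≤1+n p)) p<B) ⟩
        ε p ^ (m (suc j) + m (suc j)) ≡⟨ ^-even (m (suc j) + m (suc j))
                                               (ε≢zer (B≤n (suc j) 1+j≤r) evenPsum p Bj<p p<B p-parity)
                                               (parity-double (m (suc j))) ⟩
        pos                           ∎

    boundary-factor : ∀ {j} → suc (suc j) ≤ r → parity (B (suc j)) ≡ 0ℙ →
                      factor (B (suc j)) ≡ link ζ m (suc j)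
    boundary-factor {j} 2+j≤r even = trans (factor-even even) (cong₂ (λ x y → ζ (suc j) ^ (x + y)) a-last a-next)
      where
      a-last : a (B (suc j)) ≡ m (suc j)
      a-last = block-value (≤-trans (n≤1+n _) 2+j≤r) (B-strict (≤-trans (n≤1+n _) 2+j≤r)) ≤-refl
      a-next : a (suc (B (suc j))) ≡ m (suc (suc j))
      a-next = block-value 2+j≤r ≤-refl (B-strict 2+j≤r)

    ∏-factor-blocks : ∀ t d len → suc (t + d) ≤ r → B t + len ≡ B (suc (t + d)) →
                      EvenBoundaries t (suc (t + d)) → EvenPsumOn (B t) (B (suc (t + d))) →
                      ∏ factor (B t) len ≡ ∏ (link ζ m) t d · factor (B (suc (t + d)))
    ∏-factor-blocks t zero len 1+t≤r Bt+len≡ _ evenPsum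
      rewrite +-identityʳ t | +-cancelˡ-≡ (B t) len (ns (suc t)) Bt+len≡ = block-product 1+t≤r evenPsum
    ∏-factor-blocks t (suc d) len 2+t+d≤r Bt+len≡ even-B evenPsum rewrite +-suc t d = begin
      ∏ factor (B t) len                                            ≡⟨ cong (∏ factor (B t)) len≡ ⟩
      ∏ factor (B t) (len′ + ns (suc s))                            ≡⟨ ∏-+ factor (B t) len′ (ns (suc s)) ⟩
      ∏ factor (B t) len′ · ∏ factor (B t + len′) (ns (suc s))
        ≡⟨ cong₂ _·_ ih (cong (λ x → ∏ factor x (ns (suc s))) Bt+len′≡) ⟩
      ∏ (link ζ m) t d · factor (B s) · ∏ factor (B s) (ns (suc s))
        ≡⟨ cong₂ (λ x y → ∏ (link ζ m) t d · x · y) (boundary-factor 2+t+d≤r s-even)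
                                                    (block-product 2+t+d≤r last-block) ⟩
      ∏ (link ζ m) t (suc d) · factor (B (suc s))                   ∎
      where
      s : ℕ
      s = suc (t + d)
      s-even : parity (B s) ≡ 0ℙ
      s-even = even-B s (s≤s (m≤m+n t d)) ≤-refl
      Bt≤Bs : B t ≤ B s
      Bt≤Bs = psum-mono ns s (≤-trans (m≤m+n t d) (n≤1+n _))
      last-block : EvenPsumOn (B s) (B (suc s))
      last-block e Bs<e = evenPsum e (≤-<-trans Bt≤Bs Bs<e)
      len′ : ℕ
      len′ = B s ∸ B t
      Bt+len′≡ : B t + len′ ≡ B s
      Bt+len′≡ = m+[n∸m]≡n Bt≤Bs
      len≡ : len ≡ len′ + ns (suc s)
      len≡ = +-cancelˡ-≡ (B t) len (len′ + ns (suc s))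
               (trans Bt+len≡ (trans (cong (_+ ns (suc s)) (sym Bt+len′≡)) (+-assoc (B t) len′ _)))
      ih : ∏ factor (B t) len′ ≡ ∏ (link ζ m) t d · factor (B s)
      ih = ∏-factor-blocks t d len′ (≤-trans (n≤1+n _) 2+t+d≤r) Bt+len′≡
             (λ i t<i i<s → even-B i t<i (≤-trans i<s (n≤1+n _)))
             (λ e Bt<e e<Bs → evenPsum e Bt<e (<-trans e<Bs (B-strict 2+t+d≤r)))

    ∏-factor-chain : ∀ t s → t < s → s ≤ r → parity (B s) ≡ 1ℙ → EvenBoundaries t s →
                     EvenPsumOn (B t) (B s) → ∏ factor (B t) (B s ∸ B t) ≡ chainTo ζ m (suc t) s
    -- Abstracting s ∸ suc t as d also turns the goal's chainTo ζ m (suc t) s into chain ζ m (suc t) d.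
    ∏-factor-chain t s t<s with s ∸ suc t | m+[n∸m]≡n t<s
    ... | d | refl = λ s≤r s-odd even-B evenPsum → begin
      ∏ factor (B t) (B s ∸ B t)      ≡⟨ ∏-factor-blocks t d _ s≤r (m+[n∸m]≡n (<⇒≤ (B-< t<s s≤r)))
                                                           even-B evenPsum ⟩
      ∏ (link ζ m) t d · factor (B s) ≡⟨ cong (∏ (link ζ m) t d ·_) (factor-odd s-odd) ⟩
      ∏ (link ζ m) t d · pos          ≡⟨ ·-identityʳ _ ⟩
      ∏ (link ζ m) t d                ≡⟨ chain≡∏ ζ m t d ⟨
      chain ζ m (suc t) d             ∎

    ζ-chain-from-start : ∀ s → 1 ≤ s → s ≤ r → parity (B s) ≡ 1ℙ → EvenBoundaries 0 s →
                         ζ s ≡ chainTo ζ m 1 s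
    ζ-chain-from-start s 1≤s s≤r s-odd even-B = begin
      ε (B s)                   ≡⟨ cong ε Bs≡ ⟨
      ε (1 + len)               ≡⟨ telescope 1 len ≤-refl refl len-even
                                     (≤-trans (≤-reflexive Bs≡) (B≤n s s≤r))
                                     (λ e 1<e e< → evenPsum e (≤-<-trans z≤n 1<e)
                                                              (<-≤-trans e< (≤-reflexive Bs≡))) ⟩
      ε 1 · ∏ factor 1 len      ≡⟨ cong (_· ∏ factor 1 len) (N4 (≤-trans 1≤Bs (B≤n s s≤r))) ⟩
      factor 1 · ∏ factor 1 len ≡⟨ ∏-cons factor 0 len ⟨
      ∏ factor 0 (1 + len)      ≡⟨ cong (∏ factor 0) Bs≡ ⟩
      ∏ factor 0 (B s)          ≡⟨ ∏-factor-chain 0 s 1≤s s≤r s-odd even-B evenPsum ⟩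
      chainTo ζ m 1 s           ∎
      where
      1≤Bs : 1 ≤ B s
      1≤Bs = B-< 1≤s s≤r
      len : ℕ
      len = B s ∸ 1
      Bs≡ : 1 + len ≡ B s
      Bs≡ = m+[n∸m]≡n 1≤Bs
      len-even : parity len ≡ 0ℙ
      len-even = parity-∸ 1≤Bs (sym s-odd)
      evenPsum : EvenPsumOn 0 (B s)
      evenPsum = evenPsumOn s≤r even-B 0 z≤n 1≤Bs refl refl

    ζ-chain : ∀ t s → 1 ≤ t → t < s → s ≤ r → parity (B t) ≡ 1ℙ → parity (B s) ≡ 1ℙ →
              parity (psum a (B s ∸ 1)) ≡ 0ℙ → EvenBoundaries t s → ζ s ≡ ζ t · chainTo ζ m (suc t) s
    ζ-chain t s 1≤t t<s s≤r t-odd s-odd before-s-even even-B = begin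
      ε (B s)                      ≡⟨ cong ε Bs≡ ⟨
      ε (B t + len)                ≡⟨ telescope (B t) len (B-< 1≤t (<⇒≤ (<-≤-trans t<s s≤r))) t-odd len-even
                                        (≤-trans (≤-reflexive Bs≡) (B≤n s s≤r))
                                        (subst (EvenPsumOn (B t)) (sym Bs≡) evenPsum) ⟩
      ε (B t) · ∏ factor (B t) len ≡⟨ cong (ε (B t) ·_) (∏-factor-chain t s t<s s≤r s-odd even-B evenPsum) ⟩
      ζ t · chainTo ζ m (suc t) s  ∎
      where
      Bt<Bs : B t < B s
      Bt<Bs = B-< t<s s≤r
      len : ℕ
      len = B s ∸ B t
      Bs≡ : B t + len ≡ B s
      Bs≡ = m+[n∸m]≡n (<⇒≤ Bt<Bs)
      len-even : parity len ≡ 0ℙ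
      len-even = parity-∸ (<⇒≤ Bt<Bs) (trans t-odd (sym s-odd))
      1≤Bs : 1 ≤ B s
      1≤Bs = ≤-<-trans z≤n Bt<Bs
      evenPsum : EvenPsumOn (B t) (B s)
      evenPsum = evenPsumOn s≤r even-B (B s ∸ 1) (∸-monoˡ-≤ 1 Bt<Bs) (≤-reflexive (m+[n∸m]≡n 1≤Bs))
                            (parity-∸ 1≤Bs (sym s-odd)) before-s-even

proposition6p2 : (n : ℕ) (a : ℕ → ℕ) (ε : ℕ → Sign) → IsNaiveEGK n a ε →
    (r : ℕ) (m : ℕ → ℕ) →
    (∀ s → 1 ≤ s → suc s ≤ r → m s < m (suc s)) →
    (∀ i → 1 ≤ i → i ≤ n → ∃[ s ] (1 ≤ s × s ≤ r × a i ≡ m s)) →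
    (∀ s → 1 ≤ s → s ≤ r → ∃[ i ] (1 ≤ i × i ≤ n × a i ≡ m s)) →
    IsEGK n r (λ s → count a n (m s)) m (λ s → ε (psum (λ j → count a n (m j)) s))
proposition6p2 n a ε naive r m m-step value attained = record
  { E0  = λ { (suc s) _ 1+s≤r → ns-pos 1+s≤r }
  ; E1a = B-r
  ; E1b = m-step
  ; E2  = λ s 1≤s s≤r Bs-even → subst (λ x → ζ s ≢ zer ⇔ Even x) (psum-a-B s s≤r)
                                       (N2 (B s) (B-< 1≤s s≤r) (B≤n s s≤r) Bs-even)
  ; E3  = λ s 1≤s s≤r Bs-odd → N3 (B s) (B-< 1≤s s≤r) (B≤n s s≤r) Bs-odd
  ; E3a = λ s 1≤s s≤r Bs-odd below-even →
            ζ-chain-from-start s 1≤s s≤r (¬even⇒parity≡1ℙ _ Bs-odd)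
                               (λ i 0<i i<s → even⇒parity≡0ℙ (below-even i 0<i i<s))
  ; E3b = λ s 1≤s s≤r Bs-odd before-s-even t 1≤t t<s Bt-odd between-even →
            ζ-chain t s 1≤t t<s s≤r (¬even⇒parity≡1ℙ _ Bt-odd) (¬even⇒parity≡1ℙ _ Bs-odd)
                    (even⇒parity≡0ℙ (subst Even (sym (psum-a-before-B s 1≤s s≤r)) before-s-even))
                    (λ i t<i i<s → even⇒parity≡0ℙ (between-even i t<i i<s))
  }
  where
  open IsNaiveEGK naive
  open NaiveEGK naive
  open Grouping r m m-step value attained
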